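{- For an $M$-memory $(T(n),IO(n))$-time $S(n)$-space RATM-TLM $\mathcal{M}$, a RATM-BIO $\mathcal{M}'$ can simulate $\mathcal{M}$ with $O(IO(n)\cdot S(n))$ external access trace complexity.
   Context: A RATM-TLM (random access Turing machine with two-level memory) with main memory size $M$ has a main memory tape of exactly $M$ cells, an unbounded external memory tape, and an address tape for the external memory, together with random access to the main memory: it has a random access state $q_a$, upon entering which the main memory head jumps in one step to the main memory cell whose address has been written (on an address tape for the main memory). Besides, it has a finite set of states, input and tape alphabets with a blank symbol, a transition function $\delta:Q\times\Gamma\to Q\times\Gamma\times\{L,S,R\}$ on the main memory tape, an accepting state, and Read and Write states: entering a Read state, the machine writes an external address $addr$ and the main memory cell under the head receives the content of external cell $addr$; entering a Write state, the external cell $addr$ receives the content of the main memory cell under the head; each Read/Write takes one unit of time. Its time on an input is the number of transitions other than Read/Write operations, its IO time is the number of Read/Write operations, and its space is the number of external tape cells used; it is $M$-memory $(T(n),IO(n))$-time $S(n)$-space if its main memory size is $M$ and its time, IO time and space are $O(T(n))$, $O(IO(n))$, $O(S(n))$ respectively on inputs of size $n$ (for almost all $n$). A RATM-BIO (random access Turing machine with blocking IO) with main memory size $M$ has four tapes: a main memory tape of $M$ cells with its address tape, and an unbounded external memory tape with its address tape; it has a main head with random access on the main memory tape and an external head that moves only one cell at a time on the external tape. Its transitions are partitioned into main memory computation transitions (the main head operates, the external head halts), external memory access transitions (the main head halts, the external head moves), and Read/Write transitions. On entering a Read (Write) state, the main head writes an external address on the external address tape and halts; the external head then moves cell by cell to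 the designated cell, whose content then replaces (is replaced by) the content of the main memory cell under the main head; then the external head halts and the main head resumes. The external access trace complexity of a RATM-BIO is the total number of moves of the external head. -}

module Defs where

open import Data.Nat using (ℕ; zero; suc; _+_; _*_; _≤_; _<_; _<?_; _⊔_; ∣_-_∣)
open import Data.Fin using (Fin; zero; suc; toℕ; fromℕ<)
open import Data.List using (List; []; _∷_; length; map)
open import Data.Vec using (Vec; replicate; lookup; _[_]≔_)
open import Data.Product using (Σ; ∃; ∃-syntax; _×_; _,_)
open import Data.Sum using (_⊎_)
open import Data.Empty using (⊥)
open import Data.Unit using (⊤)
open import Relation.Nullary using (yes; no)
open import Relation.Binary.PropositionalEquality using (_≡_)
open import Function.Bundles using (_⇔_)

data Move : Set where
  L S R : Move

moveN : Move → ℕ → ℕ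
moveN L zero    = zero
moveN L (suc i) = i
moveN S i       = i
moveN R i       = suc i

jumpFin : (m : ℕ) → ℕ → Fin (suc m) → Fin (suc m)
jumpFin m k i with k <? suc m
... | yes k<M = fromℕ< k<M
... | no  _   = i

-- head move on the main memory tape of suc m cells (stays at both ends)
moveFin : (m : ℕ) → Move → Fin (suc m) → Fin (suc m)
moveFin m d i = jumpFin m (moveN d (toℕ i)) i

-- unbounded tapes with finite support, stored as a list; cells beyond
-- the list hold the blank symbol b
readT : {A : Set} → A → List A → ℕ → A
readT b []       _       = b
readT b (x ∷ xs) zero    = x
readT b (x ∷ xs) (suc i) = readT b xs i

writeT : {A : Set} → A → List A → ℕ → A → List A
writeT b []       zero    a = a ∷ []
writeT b []       (suc i) a = b ∷ writeT b [] i a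
writeT b (x ∷ xs) zero    a = a ∷ xs
writeT b (x ∷ xs) (suc i) a = x ∷ writeT b xs i a

-- address tape alphabet: 0 = blank, 1 = bit 0, 2 = bit 1
ASym : Set
ASym = Fin 3

-- the address written on an address tape: binary, least significant bit
-- in cell 0, terminated by the first blank
decode : List ASym → ℕ
decode []                  = 0
decode (zero ∷ _)          = 0
decode (suc zero ∷ xs)     = 2 * decode xs
decode (suc (suc _) ∷ xs)  = suc (2 * decode xs)

-- transition of a main memory computation step: new state, symbol written
-- and move on the main memory tape, on the main address tape and on the
-- external address tape
Out : ℕ → ℕ → Set
Out nQ g = Fin nQ × Fin (suc g) × Move × ASym × Move × ASym × Move

-- RATM-TLM with main memory size M = suc m and input alphabet Fin s

data TLMKind : Set where
  compute randomAccess read write accept reject : TLMKind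

record TLM (s m : ℕ) : Set where
  field
    nQ    : ℕ
    g     : ℕ                       -- tape alphabet Fin (suc g), blank = zero
    inp   : Fin s → Fin g           -- input symbol a is tape symbol suc (inp a)
    start : Fin nQ
    kind  : Fin nQ → TLMKind
    δ     : Fin nQ → Fin (suc g) → ASym → ASym → Out nQ g
    next  : Fin nQ → Fin nQ         -- successor state of random access / Read / Write states

module TLMSem {s m : ℕ} (𝕄 : TLM s m) where
  open TLM 𝕄

  record Conf : Set where
    constructor conf
    field
      st    : Fin nQ
      mem   : Vec (Fin (suc g)) (suc m)
      mh    : Fin (suc m)
      atape : List ASym
      ahead : ℕ
      etape : List ASym
      ehead : ℕ
      ext   : List (Fin (suc g))
      time  : ℕ
      io    : ℕ
      space : ℕ    -- number of leading external cells used (1 + largest used address)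

  init : List (Fin s) → Conf
  init w = conf start (replicate _ zero) zero [] 0 [] 0
                (map (λ a → suc (inp a)) w) 0 0 (length w)

  step : Conf → Conf
  step c with kind (Conf.st c)
  ... | compute with δ (Conf.st c) (lookup (Conf.mem c) (Conf.mh c))
                       (readT zero (Conf.atape c) (Conf.ahead c))
                       (readT zero (Conf.etape c) (Conf.ehead c))
  ...   | (q , a , d , b₁ , d₁ , b₂ , d₂) =
          conf q (Conf.mem c [ Conf.mh c ]≔ a) (moveFin m d (Conf.mh c))
               (writeT zero (Conf.atape c) (Conf.ahead c) b₁) (moveN d₁ (Conf.ahead c))
               (writeT zero (Conf.etape c) (Conf.ehead c) b₂) (moveN d₂ (Conf.ehead c))
               (Conf.ext c) (suc (Conf.time c)) (Conf.io c) (Conf.space c)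
  step c | randomAccess =
          conf (next (Conf.st c)) (Conf.mem c)
               (jumpFin m (decode (Conf.atape c)) (Conf.mh c))
               (Conf.atape c) (Conf.ahead c) (Conf.etape c) (Conf.ehead c)
               (Conf.ext c) (suc (Conf.time c)) (Conf.io c) (Conf.space c)
  step c | read =
          let addr = decode (Conf.etape c) in
          conf (next (Conf.st c))
               (Conf.mem c [ Conf.mh c ]≔ readT zero (Conf.ext c) addr) (Conf.mh c)
               (Conf.atape c) (Conf.ahead c) (Conf.etape c) (Conf.ehead c)
               (Conf.ext c) (Conf.time c) (suc (Conf.io c)) (Conf.space c ⊔ suc addr)
  step c | write =
          let addr = decode (Conf.etape c) in
          conf (next (Conf.st c)) (Conf.mem c) (Conf.mh c)
               (Conf.atape c) (Conf.ahead c) (Conf.etape c) (Conf.ehead c)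
               (writeT zero (Conf.ext c) addr (lookup (Conf.mem c) (Conf.mh c)))
               (Conf.time c) (suc (Conf.io c)) (Conf.space c ⊔ suc addr)
  step c | accept = c
  step c | reject = c

  run : ℕ → Conf → Conf
  run zero    c = c
  run (suc k) c = run k (step c)

  IsAccept : TLMKind → Set
  IsAccept accept = ⊤
  IsAccept _      = ⊥

  IsHalt : TLMKind → Set
  IsHalt accept = ⊤
  IsHalt reject = ⊤
  IsHalt _      = ⊥

  Accepts : List (Fin s) → Set
  Accepts w = ∃[ k ] IsAccept (kind (Conf.st (run k (init w))))

-- 𝕄 is M-memory (T(n), IO(n))-time S(n)-space (M = suc m is built into the type)
TimeIOSpace : {s m : ℕ} → (T IO Sp : ℕ → ℕ) → TLM s m → Set
TimeIOSpace {s} T IO Sp 𝕄 =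
  ∃[ c ] ∃[ N ] ∀ (w : List (Fin s)) → N ≤ length w →
    ∃[ k ] (let C = run k (init w) in
       IsHalt (TLM.kind 𝕄 (Conf.st C))
     × Conf.time C  ≤ c * T (length w)
     × Conf.io C    ≤ c * IO (length w)
     × Conf.space C ≤ c * Sp (length w))
  where open TLMSem 𝕄

-- RATM-BIO with main memory size M = suc m and input alphabet Fin s

data BIOKind : Set where
  compute randomAccess extAccess read write accept reject : BIOKind

record BIO (s m : ℕ) : Set where
  field
    nQ    : ℕ
    g     : ℕ
    inp   : Fin s → Fin g
    start : Fin nQ
    kind  : Fin nQ → BIOKind
    δ     : Fin nQ → Fin (suc g) → ASym → ASym → Out nQ g
    δx    : Fin nQ → Fin (suc g) → Fin nQ × Move
    next  : Fin nQ → Fin nQ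

module BIOSem {s m : ℕ} (𝕄 : BIO s m) where
  open BIO 𝕄

  record Conf : Set where
    constructor conf
    field
      st    : Fin nQ
      mem   : Vec (Fin (suc g)) (suc m)
      mh    : Fin (suc m)
      atape : List ASym
      ahead : ℕ
      etape : List ASym
      ehead : ℕ
      ext   : List (Fin (suc g))
      xh    : ℕ    -- position of the external head
      trace : ℕ    -- number of moves of the external head so far

  init : List (Fin s) → Conf
  init w = conf start (replicate _ zero) zero [] 0 [] 0
                (map (λ a → suc (inp a)) w) 0 0

  step : Conf → Conf
  step c with kind (Conf.st c)
  ... | compute with δ (Conf.st c) (lookup (Conf.mem c) (Conf.mh c))
                       (readT zero (Conf.atape c) (Conf.ahead c))
                       (readT zero (Conf.etape c) (Conf.ehead c))
  ...   | (q , a , d , b₁ , d₁ , b₂ , d₂) =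
          conf q (Conf.mem c [ Conf.mh c ]≔ a) (moveFin m d (Conf.mh c))
               (writeT zero (Conf.atape c) (Conf.ahead c) b₁) (moveN d₁ (Conf.ahead c))
               (writeT zero (Conf.etape c) (Conf.ehead c) b₂) (moveN d₂ (Conf.ehead c))
               (Conf.ext c) (Conf.xh c) (Conf.trace c)
  step c | randomAccess =
          conf (next (Conf.st c)) (Conf.mem c)
               (jumpFin m (decode (Conf.atape c)) (Conf.mh c))
               (Conf.atape c) (Conf.ahead c) (Conf.etape c) (Conf.ehead c)
               (Conf.ext c) (Conf.xh c) (Conf.trace c)
  step c | extAccess with δx (Conf.st c) (readT zero (Conf.ext c) (Conf.xh c))
  ...   | (q , d) =
          conf q (Conf.mem c) (Conf.mh c)
               (Conf.atape c) (Conf.ahead c) (Conf.etape c) (Conf.ehead c)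
               (Conf.ext c) (moveN d (Conf.xh c))
               (Conf.trace c + ∣ Conf.xh c - moveN d (Conf.xh c) ∣)
  step c | read =
          let addr = decode (Conf.etape c) in
          conf (next (Conf.st c))
               (Conf.mem c [ Conf.mh c ]≔ readT zero (Conf.ext c) addr) (Conf.mh c)
               (Conf.atape c) (Conf.ahead c) (Conf.etape c) (Conf.ehead c)
               (Conf.ext c) addr (Conf.trace c + ∣ Conf.xh c - addr ∣)
  step c | write =
          let addr = decode (Conf.etape c) in
          conf (next (Conf.st c)) (Conf.mem c) (Conf.mh c)
               (Conf.atape c) (Conf.ahead c) (Conf.etape c) (Conf.ehead c)
               (writeT zero (Conf.ext c) addr (lookup (Conf.mem c) (Conf.mh c)))
               addr (Conf.trace c + ∣ Conf.xh c - addr ∣)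
  step c | accept = c
  step c | reject = c

  run : ℕ → Conf → Conf
  run zero    c = c
  run (suc k) c = run k (step c)

  IsAccept : BIOKind → Set
  IsAccept accept = ⊤
  IsAccept _      = ⊥

  IsHalt : BIOKind → Set
  IsHalt accept = ⊤
  IsHalt reject = ⊤
  IsHalt _      = ⊥

  Accepts : List (Fin s) → Set
  Accepts w = ∃[ k ] IsAccept (kind (Conf.st (run k (init w))))

Simulates : {s m : ℕ} → BIO s m → TLM s m → Set
Simulates {s} 𝕄' 𝕄 = ∀ (w : List (Fin s)) → TLMSem.Accepts 𝕄 w ⇔ BIOSem.Accepts 𝕄' w

TraceComplexity : {s m : ℕ} → (F : ℕ → ℕ) → BIO s m → Set
TraceComplexity {s} F 𝕄' =
  ∃[ c ] ∃[ N ] ∀ (w : List (Fin s)) → N ≤ length w →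
    ∃[ k ] (let C = run k (init w) in
       IsHalt (BIO.kind 𝕄' (Conf.st C)) × Conf.trace C ≤ c * F (length w))
  where open BIOSem 𝕄'

{-# OPTIONS --safe #-}
module Submission where

-- The simulating RATM-BIO runs the program of the RATM-TLM unchanged and
-- never enters an external-access state, so its external head moves only
-- during Read/Write, from the previously accessed address to the new one.
-- Both addresses lie below the space used, hence each of the IO(n)
-- operations costs at most S(n) head moves. Formally, the two runs proceed
-- in lockstep with identical states and tapes, under the invariant
-- "head ≤ space and trace ≤ io * space".

open import Defs
open import Data.Nat using (ℕ; suc; _+_; _*_; _≤_; z≤n; _⊔_; ∣_-_∣)
open import Data.Nat.Properties
open import Data.Product using (Σ; _×_; _,_)
open import Data.List using (length)
open import Data.Unit using (tt)
open import Function using (id)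
open import Function.Bundles using (_⇔_; mk⇔; Equivalence)

head-move-≤ : ∀ {x s} a → x ≤ s → ∣ x - a ∣ ≤ s ⊔ suc a
head-move-≤ {x} a x≤s = ≤-trans (∣m-n∣≤m⊔n x a) (⊔-mono-≤ x≤s (n≤1+n a))

trace-step-≤ : ∀ {x s t} i a → x ≤ s → t ≤ i * s →
               t + ∣ x - a ∣ ≤ suc i * (s ⊔ suc a)
trace-step-≤ {x} {s} {t} i a x≤s t≤is = begin
  t + ∣ x - a ∣          ≤⟨ +-mono-≤ t≤is' (head-move-≤ a x≤s) ⟩
  i * s' + s'            ≡⟨ +-comm (i * s') s' ⟩
  suc i * s'             ∎
  where
  open ≤-Reasoning
  s' = s ⊔ suc a
  t≤is' : t ≤ i * s'
  t≤is' = ≤-trans t≤is (*-monoʳ-≤ i (m≤m⊔n s (suc a)))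

*-mono-≤-scaled : ∀ {a b} c d x y → a ≤ c * x → b ≤ d * y → a * b ≤ (c * d) * (x * y)
*-mono-≤-scaled c d x y a≤cx b≤dy =
  ≤-trans (*-mono-≤ a≤cx b≤dy) (≤-reflexive ([m*n]*[o*p]≡[m*o]*[n*p] c x d y))

toBIOKind : TLMKind → BIOKind
toBIOKind compute      = compute
toBIOKind randomAccess = randomAccess
toBIOKind read         = read
toBIOKind write        = write
toBIOKind accept       = accept
toBIOKind reject       = reject

module Simulation {s m : ℕ} (𝕄 : TLM s m) where
  open TLM 𝕄
  module T = TLMSem 𝕄

  simulator : BIO s m
  simulator = record
    { nQ = nQ ; g = g ; inp = inp ; start = start
    ; kind = λ q → toBIOKind (kind q) ; δ = δ
    ; δx = λ q _ → q , Defs.S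
    ; next = next
    }

  module B = BIOSem simulator

  isAccept-toBIOKind : ∀ k → T.IsAccept k ⇔ B.IsAccept (toBIOKind k)
  isAccept-toBIOKind compute      = mk⇔ (λ ()) (λ ())
  isAccept-toBIOKind randomAccess = mk⇔ (λ ()) (λ ())
  isAccept-toBIOKind read         = mk⇔ (λ ()) (λ ())
  isAccept-toBIOKind write        = mk⇔ (λ ()) (λ ())
  isAccept-toBIOKind accept       = mk⇔ id id
  isAccept-toBIOKind reject       = mk⇔ (λ ()) (λ ())

  isHalt-toBIOKind : ∀ k → T.IsHalt k → B.IsHalt (toBIOKind k)
  isHalt-toBIOKind accept _ = tt
  isHalt-toBIOKind reject _ = tt

  data Tracks : T.Conf → B.Conf → Set where
    tracks : ∀ {st mem mh at ah et eh ext time io sp xh tr} →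
             xh ≤ sp → tr ≤ io * sp →
             Tracks (T.conf st mem mh at ah et eh ext time io sp)
                    (B.conf st mem mh at ah et eh ext xh tr)

  tracks-init : ∀ w → Tracks (T.init w) (B.init w)
  tracks-init w = tracks z≤n z≤n

  tracks-step : ∀ {c c'} → Tracks c c' → Tracks (T.step c) (B.step c')
  tracks-step {T.conf st _ _ _ _ et _ _ _ io sp} (tracks xh≤sp tr≤io*sp) with kind st
  ... | compute      = tracks xh≤sp tr≤io*sp
  ... | randomAccess = tracks xh≤sp tr≤io*sp
  ... | read         = tracks (m≤n⇒m≤o⊔n sp (n≤1+n (decode et)))
                              (trace-step-≤ io (decode et) xh≤sp tr≤io*sp)
  ... | write        = tracks (m≤n⇒m≤o⊔n sp (n≤1+n (decode et)))
                              (trace-step-≤ io (decode et) xh≤sp tr≤io*sp)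
  ... | accept       = tracks xh≤sp tr≤io*sp
  ... | reject       = tracks xh≤sp tr≤io*sp

  tracks-run : ∀ k {c c'} → Tracks c c' → Tracks (T.run k c) (B.run k c')
  tracks-run 0       r = r
  tracks-run (suc k) r = tracks-run k (tracks-step r)

  tracks-run-init : ∀ k w → Tracks (T.run k (T.init w)) (B.run k (B.init w))
  tracks-run-init k w = tracks-run k (tracks-init w)

  accepts-agree : ∀ {c c'} → Tracks c c' →
                  T.IsAccept (kind (T.Conf.st c)) ⇔ B.IsAccept (BIO.kind simulator (B.Conf.st c'))
  accepts-agree {T.conf st _ _ _ _ _ _ _ _ _ _} (tracks _ _) = isAccept-toBIOKind (kind st)

  halts-agree : ∀ {c c'} → Tracks c c' →
                T.IsHalt (kind (T.Conf.st c)) → B.IsHalt (BIO.kind simulator (B.Conf.st c'))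
  halts-agree {T.conf st _ _ _ _ _ _ _ _ _ _} (tracks _ _) = isHalt-toBIOKind (kind st)

  trace-≤-io*space : ∀ {c c'} → Tracks c c' → B.Conf.trace c' ≤ T.Conf.io c * T.Conf.space c
  trace-≤-io*space (tracks _ tr≤io*sp) = tr≤io*sp

  simulates : Simulates simulator 𝕄
  simulates w = mk⇔
    (λ (k , acc) → k , Equivalence.to   (accepts-agree (tracks-run-init k w)) acc)
    (λ (k , acc) → k , Equivalence.from (accepts-agree (tracks-run-init k w)) acc)

  traceComplexity : (T IO Sp : ℕ → ℕ) → TimeIOSpace T IO Sp 𝕄 →
                    TraceComplexity (λ n → IO n * Sp n) simulator
  traceComplexity T IO Sp (c , N , bounded) = c * c , N , λ w N≤n →
    let (k , halt , _ , io≤ , space≤) = bounded w N≤n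
        r = tracks-run-init k w
        n = length w
    in k , halts-agree r halt ,
       ≤-trans (trace-≤-io*space r) (*-mono-≤-scaled c c (IO n) (Sp n) io≤ space≤)

theorem6 : {s m : ℕ} (T IO Sp : ℕ → ℕ) (𝕄 : TLM s m) →
    TimeIOSpace T IO Sp 𝕄 →
    Σ (BIO s m) (λ 𝕄' → Simulates 𝕄' 𝕄 × TraceComplexity (λ n → IO n * Sp n) 𝕄')
theorem6 T IO Sp 𝕄 bounds =
  simulator , simulates , traceComplexity T IO Sp bounds
  where open Simulation 𝕄
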